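{- Let $m\in\mathbb N$, $n\in\mathbb N^m\setminus\{1_m\}$, and let $M\in\mathbb N_0^n$ be a principal reversible cuboid. For every $\tilde n\in\mathbb N^m$ with $\tilde n\le n$, \[\mu_{\tilde n}\le\prod_{j=1}^m\tilde n_j,\] with equality if and only if $M_{[\tilde n]}$ is a principal reversible cuboid.
   Context: $\mathbb N=\{1,2,\dots\}$, $\mathbb N_0=\mathbb N\cup\{0\}$, $\langle N\rangle=\{0,\dots,N-1\}$. For $n\in\mathbb N^m$, a cuboid $M\in\mathbb N_0^n$ has entries $M_k\in\mathbb N_0$ for $k\in\mathbb N^m$, $k\le n$ componentwise; $1_m=(1,\dots,1)$, $e_j$ the $j$-th unit vector. Property (V): for all $1\le i<j\le m$ and all index vectors in range, $M_{k_1,\dots,k_i,\dots,k_j,\dots,k_m}+M_{k_1,\dots,k_i',\dots,k_j',\dots,k_m}=M_{k_1,\dots,k_i,\dots,k_j',\dots,k_m}+M_{k_1,\dots,k_i',\dots,k_j,\dots,k_m}$ (vacuous if $m=1$). $M$ is a principal reversible cuboid if it has (V), its set of entries is $\langle\prod_jn_j\rangle$, and $M_k<M_{k+le_j}$ whenever $1\le l\le n_j-k_j$ (dimensions equal to 1 allowed). For $\tilde n\le n$, $M_{[\tilde n]}=(M_k)_{k\le\tilde n}$, and $\mu_{\tilde n}=\min\{N\in\mathbb N: N\ne M_k\text{ for all }k\le\tilde n\}$. -}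

module Defs where

open import Data.Nat using (ℕ; zero; suc; _+_; _*_; _≤_; _<_)
open import Data.Fin using (Fin)
open import Data.Vec using (Vec; []; _∷_; lookup; _[_]≔_)
open import Data.Product using (_×_; Σ; ∃; ∃-syntax; _,_)
open import Relation.Binary.PropositionalEquality using (_≡_; _≢_)
open import Relation.Nullary using (¬_)

-- A cuboid M ∈ ℕ₀^n is represented as a function M : Vec ℕ m → ℕ;
-- only its values at indices k with 1 ≤ k ≤ n (componentwise) are relevant.

prod : ∀ {m} → Vec ℕ m → ℕ
prod []       = 1
prod (x ∷ xs) = x * prod xs

Positive : ∀ {m} → Vec ℕ m → Set
Positive {m} n = ∀ (j : Fin m) → 1 ≤ lookup n j

_≤ᵥ_ : ∀ {m} → Vec ℕ m → Vec ℕ m → Set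
_≤ᵥ_ {m} a b = ∀ (j : Fin m) → lookup a j ≤ lookup b j

InBox : ∀ {m} → Vec ℕ m → Vec ℕ m → Set
InBox n k = Positive k × k ≤ᵥ n

ones : (m : ℕ) → Vec ℕ m
ones zero    = []
ones (suc m) = 1 ∷ ones m

PropertyV : ∀ {m} → Vec ℕ m → (Vec ℕ m → ℕ) → Set
PropertyV {m} n M =
  ∀ (i j : Fin m) → Data.Fin._<_ i j →
  ∀ (k : Vec ℕ m) (a b : ℕ) →
  InBox n k → 1 ≤ a → a ≤ lookup n i → 1 ≤ b → b ≤ lookup n j →
  M k + M ((k [ i ]≔ a) [ j ]≔ b) ≡ M (k [ j ]≔ b) + M (k [ i ]≔ a)

EntriesAreRange : ∀ {m} → Vec ℕ m → (Vec ℕ m → ℕ) → Set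
EntriesAreRange {m} n M =
  (∀ (k : Vec ℕ m) → InBox n k → M k < prod n) ×
  (∀ (N : ℕ) → N < prod n → ∃[ k ] (InBox n k × M k ≡ N))

StrictlyIncreasing : ∀ {m} → Vec ℕ m → (Vec ℕ m → ℕ) → Set
StrictlyIncreasing {m} n M =
  ∀ (k : Vec ℕ m) (j : Fin m) (l : ℕ) → InBox n k →
  1 ≤ l → l + lookup k j ≤ lookup n j →
  M k < M (k [ j ]≔ (lookup k j + l))

PRC : ∀ {m} → Vec ℕ m → (Vec ℕ m → ℕ) → Set
PRC n M = PropertyV n M × EntriesAreRange n M × StrictlyIncreasing n M

IsMu : ∀ {m} → Vec ℕ m → (Vec ℕ m → ℕ) → ℕ → Set
IsMu {m} ñ M N =
  1 ≤ N ×
  (∀ (k : Vec ℕ m) → InBox ñ k → N ≢ M k) ×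
  (∀ (N' : ℕ) → 1 ≤ N' → N' < N → ∃[ k ] (InBox ñ k × M k ≡ N'))

module Submission where

-- The
-- restriction M_[ñ] has P = ∏ ñ_j entries, and its corner entry M_{1_m} is 0,
-- because strict monotonicity along every axis makes M_{1_m} the least entry
-- of M, while 0 is an entry.  Hence if 1,…,P were all entries of M_[ñ], the P
-- entries would cover the P + 1 values 0,…,P, contradicting the pigeonhole
-- principle; so the least missing positive value μ_ñ exists and μ_ñ ≤ P.
-- If μ_ñ = P, the entries cover 0,…,P-1 exactly once each, so no entry can be
-- ≥ P (pigeonhole again), i.e. the entries of M_[ñ] form ⟨P⟩; property (V)
-- and monotonicity are inherited from M, so M_[ñ] is principal reversible.
-- Conversely, if the entries of M_[ñ] form ⟨P⟩ then no positive value below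
-- P is missing, so μ_ñ ≥ P.

open import Defs
open import Data.Nat using (ℕ; zero; suc; _+_; _∸_; _≤_; _<_; z≤n; s≤s; _≤?_; _≟_)
open import Data.Nat.Properties
open import Data.Nat.Induction using (<-wellFounded)
open import Induction.WellFounded using (Acc; acc)
open import Data.Fin using (Fin; toℕ; fromℕ<; remQuot; combine; punchIn; punchOut)
  renaming (zero to fzero; suc to fsuc)
import Data.Fin.Properties as Finₚ
open import Data.Vec using (Vec; []; _∷_; lookup; _[_]≔_; sum)
open import Data.Vec.Properties
  using (lookup∘update; lookup∘update′; []≔-idempotent; []≔-lookup; tabulate∘lookup; tabulate-cong)
open import Data.Product using (_×_; ∃-syntax; _,_; proj₁; proj₂)
open import Data.Empty using (⊥-elim)
open import Data.Sum using (_⊎_; inj₁; inj₂; [_,_])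
open import Function using (_∘_)
open import Relation.Binary.PropositionalEquality using (_≡_; refl; sym; trans; cong; cong₂; subst; module ≡-Reasoning)
open import Relation.Nullary using (¬_; yes; no)
open import Relation.Nullary.Decidable using (map′)
open import Relation.Unary using (Decidable)
open import Function.Bundles using (_⇔_; mk⇔)

hits-below⇒≤ : ∀ {P Q} (g : Fin P → ℕ) → (∀ v → v < Q → ∃[ i ] g i ≡ v) → Q ≤ P
hits-below⇒≤ {P} {Q} g hits with Q ≤? P
... | yes Q≤P = Q≤P
... | no Q≰P with Finₚ.pigeonhole (≰⇒> Q≰P) (λ v → proj₁ (hits (toℕ v) (Finₚ.toℕ<n v)))
... | u , v , u<v , same-preimage = ⊥-elim (<-irrefl u≡v u<v)
  where
  u≡v : toℕ u ≡ toℕ v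
  u≡v = trans (sym (proj₂ (hits (toℕ u) (Finₚ.toℕ<n u))))
          (trans (cong g same-preimage) (proj₂ (hits (toℕ v) (Finₚ.toℕ<n v))))

-- If moreover some point takes a value ≥ Q, that point is not needed to hit
-- the values below Q, so Q < P.
hits-below-and-above⇒< : ∀ {P Q} (g : Fin P → ℕ) → (∀ v → v < Q → ∃[ i ] g i ≡ v) →
                         ∀ i₀ → Q ≤ g i₀ → Q < P
hits-below-and-above⇒< {suc P} {Q} g hits i₀ Q≤gi₀ = s≤s (hits-below⇒≤ (g ∘ punchIn i₀) hits-avoiding-i₀)
  where
  hits-avoiding-i₀ : ∀ v → v < Q → ∃[ i ] g (punchIn i₀ i) ≡ v
  hits-avoiding-i₀ v v<Q with hits v v<Q
  ... | i , gi≡v with i₀ Finₚ.≟ i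
  ...   | yes refl = ⊥-elim (<⇒≱ v<Q (subst (Q ≤_) gi≡v Q≤gi₀))
  ...   | no i₀≢i = punchOut i₀≢i , trans (cong g (Finₚ.punchIn-punchOut i₀≢i)) gi≡v

least-failure : ∀ {A : ℕ → Set} → Decidable A → ∀ B →
                (∀ N → N < B → A N) ⊎ ∃[ μ ] (μ < B × ¬ A μ × (∀ N → N < μ → A N))
least-failure A? zero = inj₁ λ _ ()
least-failure A? (suc B) with least-failure A? B
... | inj₂ (μ , μ<B , ¬Aμ , below) = inj₂ (μ , m<n⇒m<1+n μ<B , ¬Aμ , below)
... | inj₁ below with A? B
...   | no ¬AB = inj₂ (B , ≤-refl , ¬AB , below)
...   | yes AB = inj₁ λ N N<1+B → [ below N , (λ { refl → AB }) ] (m<1+n⇒m<n∨m≡n N<1+B)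

lookup-ext : ∀ {m} (a b : Vec ℕ m) → (∀ j → lookup a j ≡ lookup b j) → a ≡ b
lookup-ext a b same = trans (sym (tabulate∘lookup a)) (trans (tabulate-cong same) (tabulate∘lookup b))

ones-lookup : ∀ m (j : Fin m) → lookup (ones m) j ≡ 1
ones-lookup (suc m) fzero    = refl
ones-lookup (suc m) (fsuc j) = ones-lookup m j

ones-inBox : ∀ {m} (n : Vec ℕ m) → Positive n → InBox n (ones m)
ones-inBox {m} n pos = (λ j → ≤-reflexive (sym (ones-lookup m j)))
                     , (λ j → subst (_≤ lookup n j) (sym (ones-lookup m j)) (pos j))

inBox-mono : ∀ {m} (ñ n k : Vec ℕ m) → ñ ≤ᵥ n → InBox ñ k → InBox n k
inBox-mono _ _ _ ñ≤n (pos , k≤ñ) = pos , λ j → ≤-trans (k≤ñ j) (ñ≤n j)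

inBox-update : ∀ {m} (n k : Vec ℕ m) j v → InBox n k → 1 ≤ v → v ≤ lookup n j → InBox n (k [ j ]≔ v)
inBox-update n k j v (pos , k≤n) 1≤v v≤nⱼ = pos′ , k′≤n
  where
  pos′ : Positive (k [ j ]≔ v)
  pos′ j′ with j′ Finₚ.≟ j
  ... | yes refl = subst (1 ≤_) (sym (lookup∘update j k v)) 1≤v
  ... | no j′≢j  = subst (1 ≤_) (sym (lookup∘update′ j′≢j k v)) (pos j′)
  k′≤n : (k [ j ]≔ v) ≤ᵥ n
  k′≤n j′ with j′ Finₚ.≟ j
  ... | yes refl = subst (_≤ lookup n j) (sym (lookup∘update j k v)) v≤nⱼ
  ... | no j′≢j  = subst (_≤ lookup n j′) (sym (lookup∘update′ j′≢j k v)) (k≤n j′)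

-- The points of the box [1_m, ñ], listed by Fin (∏ ñ) in mixed-radix order.
boxPoint : ∀ {m} (ñ : Vec ℕ m) → Fin (prod ñ) → Vec ℕ m
boxPoint []       _ = []
boxPoint (x ∷ xs) i = suc (toℕ (proj₁ (remQuot {x} (prod xs) i))) ∷ boxPoint xs (proj₂ (remQuot {x} (prod xs) i))

boxPoint-inBox : ∀ {m} (ñ : Vec ℕ m) i → InBox ñ (boxPoint ñ i)
boxPoint-inBox []       i = (λ ()) , (λ ())
boxPoint-inBox (x ∷ xs) i = pos , below
  where
  tail-inBox : InBox xs (boxPoint xs (proj₂ (remQuot {x} (prod xs) i)))
  tail-inBox = boxPoint-inBox xs (proj₂ (remQuot {x} (prod xs) i))
  pos : Positive (boxPoint (x ∷ xs) i)
  pos fzero    = s≤s z≤n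
  pos (fsuc j) = proj₁ tail-inBox j
  below : boxPoint (x ∷ xs) i ≤ᵥ (x ∷ xs)
  below fzero    = Finₚ.toℕ<n (proj₁ (remQuot {x} (prod xs) i))
  below (fsuc j) = proj₂ tail-inBox j

boxPoint-onto : ∀ {m} (ñ k : Vec ℕ m) → InBox ñ k → ∃[ i ] boxPoint ñ i ≡ k
boxPoint-onto []       []             _           = fzero , refl
boxPoint-onto (x ∷ xs) (zero ∷ ks)    (pos , _)   with () ← pos fzero
boxPoint-onto (x ∷ xs) (suc c ∷ ks)   (pos , k≤ñ)
  with boxPoint-onto xs ks ((pos ∘ fsuc) , (k≤ñ ∘ fsuc))
... | b , tail≡ks = combine a b , head-and-tail
  where
  a : Fin x
  a = fromℕ< (k≤ñ fzero)
  head-and-tail : boxPoint (x ∷ xs) (combine a b) ≡ suc c ∷ ks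
  head-and-tail =
    trans (cong (λ qr → suc (toℕ (proj₁ qr)) ∷ boxPoint xs (proj₂ qr)) (Finₚ.remQuot-combine {x} {prod xs} a b))
          (cong₂ _∷_ (cong suc (Finₚ.toℕ-fromℕ< (k≤ñ fzero))) tail≡ks)

sum-lower : ∀ {m} (k : Vec ℕ m) j v → v < lookup k j → sum (k [ j ]≔ v) < sum k
sum-lower (x ∷ k) fzero    v v<x = +-monoˡ-< (sum k) v<x
sum-lower (x ∷ k) (fsuc j) v v<k = +-monoʳ-< x (sum-lower k j v v<k)

module _ {m} (n : Vec ℕ m) (M : Vec ℕ m → ℕ) (increasing : StrictlyIncreasing n M) where

  -- Setting a coordinate ≥ 2 to 1 strictly decreases the entry: this is the
  -- monotonicity axiom applied at the lowered point with step k_j - 1.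
  lower-to-one : ∀ k j → InBox n k → 2 ≤ lookup k j → M (k [ j ]≔ 1) < M k
  lower-to-one k j k∈n 2≤kⱼ = subst (λ p → M k′ < M p) raised≡k step
    where
    k′ : Vec ℕ m
    k′ = k [ j ]≔ 1
    l : ℕ
    l = lookup k j ∸ 1
    1+l≡kⱼ : 1 + l ≡ lookup k j
    1+l≡kⱼ = m+[n∸m]≡n (≤-trans (s≤s z≤n) 2≤kⱼ)
    k′ⱼ≡1 : lookup k′ j ≡ 1
    k′ⱼ≡1 = lookup∘update j k 1
    step : M k′ < M (k′ [ j ]≔ (lookup k′ j + l))
    step = increasing k′ j l
             (inBox-update n k j 1 k∈n (s≤s z≤n) (≤-trans (proj₁ k∈n j) (proj₂ k∈n j)))
             (∸-monoˡ-≤ 1 2≤kⱼ)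
             (subst (_≤ lookup n j) (trans (sym 1+l≡kⱼ) (trans (+-comm 1 l) (cong (l +_) (sym k′ⱼ≡1))))
                    (proj₂ k∈n j))
    raised≡k : k′ [ j ]≔ (lookup k′ j + l) ≡ k
    raised≡k = begin
      k′ [ j ]≔ (lookup k′ j + l) ≡⟨ cong (λ v → k′ [ j ]≔ (v + l)) k′ⱼ≡1 ⟩
      k′ [ j ]≔ (1 + l)           ≡⟨ []≔-idempotent k j ⟩
      k [ j ]≔ (1 + l)            ≡⟨ cong (k [ j ]≔_) 1+l≡kⱼ ⟩
      k [ j ]≔ lookup k j         ≡⟨ []≔-lookup k j ⟩
      k                           ∎
      where open ≡-Reasoning

  -- M_{1_m} ≤ M_k for every k in the box, by well-founded induction on the
  -- coordinate sum: a point other than 1_m has a coordinate ≥ 2 to lower.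
  corner-minimal : ∀ k → InBox n k → M (ones m) ≤ M k
  corner-minimal k = below-every (<-wellFounded (sum k))
    where
    below-every : ∀ {k} → Acc _<_ (sum k) → InBox n k → M (ones m) ≤ M k
    below-every {k} (acc smaller) k∈n with Finₚ.any? (λ j → 2 ≤? lookup k j)
    ... | yes (j , 2≤kⱼ) =
      ≤-trans (below-every (smaller (sum-lower k j 1 2≤kⱼ))
                           (inBox-update n k j 1 k∈n (s≤s z≤n) (≤-trans (proj₁ k∈n j) (proj₂ k∈n j))))
              (<⇒≤ (lower-to-one k j k∈n 2≤kⱼ))
    ... | no no-coordinate≥2 = ≤-reflexive (cong M (lookup-ext (ones m) k all-one))
      where
      all-one : ∀ j → lookup (ones m) j ≡ lookup k j
      all-one j = trans (ones-lookup m j)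
                        (sym (≤-antisym (≮⇒≥ (λ 1<kⱼ → no-coordinate≥2 (j , 1<kⱼ))) (proj₁ k∈n j)))

prod-positive : ∀ {m} (v : Vec ℕ m) → Positive v → 1 ≤ prod v
prod-positive []      _   = s≤s z≤n
prod-positive (x ∷ v) pos = *-mono-≤ (pos fzero) (prod-positive v (pos ∘ fsuc))

corner-zero : ∀ {m} (n : Vec ℕ m) (M : Vec ℕ m → ℕ) → Positive n →
              EntriesAreRange n M → StrictlyIncreasing n M → M (ones m) ≡ 0
corner-zero n M pos (_ , onto) increasing with onto 0 (prod-positive n pos)
... | k₀ , k₀∈n , Mk₀≡0 = n≤0⇒n≡0 (subst (M (ones _) ≤_) Mk₀≡0 (corner-minimal n M increasing k₀ k₀∈n))

PropertyV-restrict : ∀ {m} (ñ n : Vec ℕ m) (M : Vec ℕ m → ℕ) → ñ ≤ᵥ n → PropertyV n M → PropertyV ñ M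
PropertyV-restrict ñ n M ñ≤n V i j i<j k a b k∈ñ 1≤a a≤ñᵢ 1≤b b≤ñⱼ =
  V i j i<j k a b (inBox-mono ñ n k ñ≤n k∈ñ) 1≤a (≤-trans a≤ñᵢ (ñ≤n i)) 1≤b (≤-trans b≤ñⱼ (ñ≤n j))

StrictlyIncreasing-restrict : ∀ {m} (ñ n : Vec ℕ m) (M : Vec ℕ m → ℕ) →
                              ñ ≤ᵥ n → StrictlyIncreasing n M → StrictlyIncreasing ñ M
StrictlyIncreasing-restrict ñ n M ñ≤n increasing k j l k∈ñ 1≤l l+kⱼ≤ñⱼ =
  increasing k j l (inBox-mono ñ n k ñ≤n k∈ñ) 1≤l (≤-trans l+kⱼ≤ñⱼ (ñ≤n j))

Attained : ∀ {m} → Vec ℕ m → (Vec ℕ m → ℕ) → ℕ → Set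
Attained ñ M N = ∃[ k ] (InBox ñ k × M k ≡ N)

module Mu {m} (ñ : Vec ℕ m) (positive : Positive ñ) (M : Vec ℕ m → ℕ) (corner : M (ones m) ≡ 0) where

  P : ℕ
  P = prod ñ

  entry : Fin P → ℕ
  entry = M ∘ boxPoint ñ

  attained⇒entry : ∀ {v} → Attained ñ M v → ∃[ i ] entry i ≡ v
  attained⇒entry (k , k∈ñ , Mk≡v) with boxPoint-onto ñ k k∈ñ
  ... | i , pᵢ≡k = i , trans (cong M pᵢ≡k) Mk≡v

  attained? : Decidable (Attained ñ M)
  attained? v = map′ (λ (i , eᵢ≡v) → boxPoint ñ i , boxPoint-inBox ñ i , eᵢ≡v)
                     attained⇒entry
                     (Finₚ.any? (λ i → entry i ≟ v))

  -- If every positive value below Q is an entry, then (as 0 = M_{1_m} is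
  -- one too) the family of entries hits every value below Q.
  entries-below : ∀ {Q} → (∀ N → 1 ≤ N → N < Q → Attained ñ M N) → ∀ v → v < Q → ∃[ i ] entry i ≡ v
  entries-below positives zero    _   = attained⇒entry (ones m , ones-inBox ñ positive , corner)
  entries-below positives (suc v) v<Q = attained⇒entry (positives (suc v) (s≤s z≤n) v<Q)

  -- μ_ñ exists and is at most P: search for the least N with N + 1 missing;
  -- if none below P is missing, P + 1 values would be hit by P entries.
  mu-exists : ∃[ μ ] (IsMu ñ M μ × μ ≤ P)
  mu-exists with least-failure (attained? ∘ suc) P
  ... | inj₁ all-hit = ⊥-elim (<-irrefl refl (hits-below⇒≤ entry (entries-below hit-up-to-P)))
    where
    hit-up-to-P : ∀ N → 1 ≤ N → N < suc P → Attained ñ M N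
    hit-up-to-P (suc N) _ (s≤s N<P) = all-hit N N<P
  ... | inj₂ (μ , μ<P , missing , hit-below) =
    suc μ , (s≤s z≤n , (λ k k∈ñ μ≡Mk → missing (k , k∈ñ , sym μ≡Mk)) , hit-positive) , μ<P
    where
    hit-positive : ∀ N → 1 ≤ N → N < suc μ → Attained ñ M N
    hit-positive (suc N) _ (s≤s N<μ) = hit-below N N<μ

  -- If μ_ñ = P then the entries are exactly ⟨P⟩: all of 0,…,P-1 occur, and
  -- an entry ≥ P would force P + 1 points in a box of P points.
  tight⇒range : IsMu ñ M P → EntriesAreRange ñ M
  tight⇒range (_ , _ , hit-below-P) = entries<P , onto
    where
    onto : ∀ N → N < P → Attained ñ M N
    onto N N<P with entries-below hit-below-P N N<P
    ... | i , eᵢ≡N = boxPoint ñ i , boxPoint-inBox ñ i , eᵢ≡N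
    entries<P : ∀ k → InBox ñ k → M k < P
    entries<P k k∈ñ with boxPoint-onto ñ k k∈ñ
    ... | i , pᵢ≡k = ≰⇒> λ P≤Mk →
      <-irrefl refl (hits-below-and-above⇒< entry (entries-below hit-below-P) i (subst (P ≤_) (sym (cong M pᵢ≡k)) P≤Mk))

  range⇒P≤mu : ∀ {μ} → EntriesAreRange ñ M → IsMu ñ M μ → P ≤ μ
  range⇒P≤mu {μ} (_ , onto) (_ , missing , _) = ≮⇒≥ λ μ<P →
    let (k , k∈ñ , Mk≡μ) = onto μ μ<P in missing k k∈ñ (sym Mk≡μ)

lemma4 : ∀ (m : ℕ) → 1 ≤ m →
    ∀ (n : Vec ℕ m) → Positive n → ¬ (n ≡ ones m) →
    ∀ (M : Vec ℕ m → ℕ) → PRC n M →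
    ∀ (ñ : Vec ℕ m) → Positive ñ → ñ ≤ᵥ n →
    ∃[ μ ] (IsMu ñ M μ × μ ≤ prod ñ × ((μ ≡ prod ñ) ⇔ PRC ñ M))
lemma4 m _ n n-positive _ M (V , range , increasing) ñ ñ-positive ñ≤n =
  μ , isMu , μ≤P , mk⇔ tight⇒PRC PRC⇒tight
  where
  open Mu ñ ñ-positive M (corner-zero n M n-positive range increasing)
  μ : ℕ
  μ = proj₁ mu-exists
  isMu : IsMu ñ M μ
  isMu = proj₁ (proj₂ mu-exists)
  μ≤P : μ ≤ P
  μ≤P = proj₂ (proj₂ mu-exists)

  tight⇒PRC : μ ≡ P → PRC ñ M
  tight⇒PRC μ≡P = PropertyV-restrict ñ n M ñ≤n V
                , tight⇒range (subst (IsMu ñ M) μ≡P isMu)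
                , StrictlyIncreasing-restrict ñ n M ñ≤n increasing

  PRC⇒tight : PRC ñ M → μ ≡ P
  PRC⇒tight (_ , rangẽ , _) = ≤-antisym μ≤P (range⇒P≤mu rangẽ isMu)
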